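{- Let $\mathfrak M_0$ be a partial linear space and $\mathfrak M_0^\circ$ its dual, and let $G$ be $\mathbb Z$ or $C_k$ with $k$ even, $k>2$. Then $\mathfrak M_0\circledast_\circ G\cong \mathfrak M_0^\circ\circledast_\circ G$.
   Context: PLS: incidence structure $\langle S,\mathcal L,\mathrm I\rangle$, $S\cap\mathcal L=\emptyset$, every line on at least two points, every point on at least two lines, two distinct points on at most one common line. The dual $\mathfrak M_0^\circ$ of $\mathfrak M_0=\langle S_0,L_0,\mathrm I_0\rangle$ is $\langle L_0,S_0,\mathrm I_0^{ -1}\rangle$. Dual multiplying $\mathfrak M_0\circledast_\circ G$: point set $\bigcup_{i\in G}M_i$, line set $\bigcup_{i\in G}\mathcal L_i$, where $M_i=\{i\}\times S_0$, $\mathcal L_i=\{i\}\times L_0$ for even $i$ and $M_i=\{i\}\times L_0$, $\mathcal L_i=\{i\}\times S_0$ for odd $i$; points are written $(i,a)$, lines $[j,b]$, and $(i,a)\,\mathrm I\,[j,b]$ iff either $i=j$ and ($a\,\mathrm I_0\,b$ or $b\,\mathrm I_0\,a$), or $i=j+1$ and $a=b$. -}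

module Defs where

open import Data.Bool using (Bool; true; false; not)
open import Data.Nat using (ℕ; zero; suc)
open import Data.Nat.DivMod using (_mod_)
open import Data.Integer using (ℤ; +_; -[1+_]; 1ℤ) renaming (_+_ to _+ℤ_)
open import Data.Fin using (Fin; toℕ)
open import Data.Sum using (_⊎_; inj₁; inj₂)
open import Data.Product using (Σ; ∃; _×_; _,_)
open import Data.Empty using (⊥)
open import Relation.Binary.PropositionalEquality using (_≡_; _≢_)
open import Function.Bundles using (_⤖_; _⇔_; Bijection)

-- Incidence structures  ⟨S, L, I⟩  (S and L are distinct types, so
-- S ∩ L = ∅ holds automatically).

record IncStr : Set₁ where
  field
    Pt  : Set
    Ln  : Set
    Inc : Pt → Ln → Set
open IncStr public

record IsPLS (M : IncStr) : Set where
  field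
    line-two-points : ∀ (l : Ln M) → Σ (Pt M) λ a → Σ (Pt M) λ b →
      a ≢ b × Inc M a l × Inc M b l
    point-two-lines : ∀ (a : Pt M) → Σ (Ln M) λ l → Σ (Ln M) λ m →
      l ≢ m × Inc M a l × Inc M a m
    at-most-one-line : ∀ {a b : Pt M} {l m : Ln M} → a ≢ b →
      Inc M a l → Inc M b l → Inc M a m → Inc M b m → l ≡ m

dual : IncStr → IncStr
dual M = record { Pt = Ln M ; Ln = Pt M ; Inc = λ l a → Inc M a l }

infix 4 _≅_
record _≅_ (M N : IncStr) : Set where
  field
    ptBij  : Pt M ⤖ Pt N
    lnBij  : Ln M ⤖ Ln N
    incPres : ∀ (a : Pt M) (l : Ln M) →
      Inc M a l ⇔ Inc N (Bijection.to ptBij a) (Bijection.to lnBij l)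

-- Index "groups": a carrier, a parity (true = even) and  j ↦ j+1.

record Index : Set₁ where
  field
    G     : Set
    even? : G → Bool
    next  : G → G
open Index public

evenℕ : ℕ → Bool
evenℕ zero = true
evenℕ (suc n) = not (evenℕ n)

evenℤ : ℤ → Bool
evenℤ (+ n) = evenℕ n
evenℤ (-[1+ n ]) = not (evenℕ n)

ℤIdx : Index
ℤIdx = record { G = ℤ ; even? = evenℤ ; next = λ j → j +ℤ 1ℤ }

nextFin : ∀ {k} → Fin k → Fin k
nextFin {suc m} j = suc (toℕ j) mod suc m

-- The cyclic group C_k; parity of i ∈ {0,…,k-1} (well defined for even k).
CIdx : ℕ → Index
CIdx k = record { G = Fin k ; even? = λ i → evenℕ (toℕ i) ; next = nextFin }

module _ (M : IncStr) where
  private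
    S₀ = Pt M
    L₀ = Ln M

  -- M_i : S₀ for even i, L₀ for odd i ;  𝓛_i : L₀ for even i, S₀ for odd i.
  PtSort : Bool → Set
  PtSort true  = S₀
  PtSort false = L₀

  LnSort : Bool → Set
  LnSort true  = L₀
  LnSort false = S₀

  embP : (p : Bool) → PtSort p → S₀ ⊎ L₀
  embP true  a = inj₁ a
  embP false a = inj₂ a

  embL : (p : Bool) → LnSort p → S₀ ⊎ L₀
  embL true  b = inj₂ b
  embL false b = inj₁ b

  Inc± : S₀ ⊎ L₀ → S₀ ⊎ L₀ → Set
  Inc± (inj₁ a) (inj₂ b) = Inc M a b
  Inc± (inj₂ b) (inj₁ a) = Inc M a b
  Inc± (inj₁ _) (inj₁ _) = ⊥
  Inc± (inj₂ _) (inj₂ _) = ⊥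

  dualMult : Index → IncStr
  dualMult X = record
    { Pt  = Σ (G X) λ i → PtSort (even? X i)
    ; Ln  = Σ (G X) λ j → LnSort (even? X j)
    ; Inc = λ { (i , a) (j , b) →
          (i ≡ j × Inc± (embP (even? X i) a) (embL (even? X j) b))
        ⊎ (i ≡ next X j × embP (even? X i) a ≡ embL (even? X j) b) }
    }

infixl 6 _⊛∘_
_⊛∘_ : IncStr → Index → IncStr
M ⊛∘ X = dualMult M X

-- Shifting every index by one, (i , x) ↦ (i + 1 , x), is the isomorphism: since i and i + 1
-- have opposite parities, a point of the i-th layer of M becomes a point of the (i + 1)-th
-- layer of the dual, and the two kinds of incidence (inside a layer, and between (i + 1 , a)
-- and [i , a]) are carried to incidences of the same kind. All that is used of G is that
-- j ↦ j + 1 is a bijection reversing parity, which holds for ℤ and for C_k with k even.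
module Submission where

open import Defs
open import Data.Bool using (true; false; not)
open import Data.Bool.Properties using (not-involutive)
open import Data.Nat using (ℕ; zero; suc; _+_; _*_; _%_; _<_; s≤s)
open import Data.Nat.Properties using (+-comm)
open import Data.Nat.DivMod using (m<n⇒m%n≡m; n%n≡0)
open import Data.Nat.Divisibility using (_∣_; divides)
open import Data.Integer using (ℤ; +_; -[1+_]; 1ℤ; -1ℤ) renaming (_+_ to _+ℤ_)
open import Data.Integer.Properties using (+-assoc; +-identityʳ)
open import Data.Fin using (Fin; zero; suc; toℕ; fromℕ; inject₁)
open import Data.Fin.Properties using (toℕ-injective; toℕ-fromℕ; toℕ-fromℕ<; toℕ-inject₁; toℕ<n)
open import Data.Fin.Relation.Unary.Top using (view; ‵fromℕ; ‵inj₁)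
open import Data.Sum using (_⊎_; inj₁; inj₂; swap)
open import Data.Sum.Properties using (swap-involutive)
open import Data.Sum.Function.Propositional using (_⊎-⇔_)
open import Data.Product using (_×_; _,_)
open import Data.Product.Function.NonDependent.Propositional using (_×-⇔_)
open import Data.Product.Function.Dependent.Propositional using (Σ-↔)
open import Function using (Inverse)
open import Function.Bundles using (_↔_; _⇔_; mk↔ₛ′; mk⇔)
open import Function.Construct.Identity using (↔-id; ⇔-id)
open import Function.Properties.Inverse using (↔⇒⤖)
open import Relation.Binary.PropositionalEquality using (_≡_; refl; sym; trans; cong; module ≡-Reasoning)

record Alternating (X : Index) : Set where
  field
    prev       : G X → G X
    next-prev  : ∀ j → next X (prev j) ≡ j
    prev-next  : ∀ i → prev (next X i) ≡ i
    even?-next : ∀ i → even? X (next X i) ≡ not (even? X i)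

  next-injective : ∀ {i j} → next X i ≡ next X j → i ≡ j
  next-injective {i} {j} e = trans (sym (prev-next i)) (trans (cong prev e) (prev-next j))

  next-↔ : G X ↔ G X
  next-↔ = mk↔ₛ′ (next X) prev next-prev prev-next

swap-≡-⇔ : {A B : Set} {x y : A ⊎ B} → x ≡ y ⇔ swap x ≡ swap y
swap-≡-⇔ {x = x} {y} = mk⇔ (cong swap) λ e →
  trans (sym (swap-involutive x)) (trans (cong swap e) (swap-involutive y))

module _ (M : IncStr) where

  PtSort-dual-↔ : ∀ {p q} → q ≡ not p → PtSort M p ↔ PtSort (dual M) q
  PtSort-dual-↔ {true}  refl = ↔-id _
  PtSort-dual-↔ {false} refl = ↔-id _

  LnSort-dual-↔ : ∀ {p q} → q ≡ not p → LnSort M p ↔ LnSort (dual M) q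
  LnSort-dual-↔ {true}  refl = ↔-id _
  LnSort-dual-↔ {false} refl = ↔-id _

  embP-dual : ∀ {p q} (e : q ≡ not p) (a : PtSort M p) →
    embP (dual M) q (Inverse.to (PtSort-dual-↔ e) a) ≡ swap (embP M p a)
  embP-dual {true}  refl a = refl
  embP-dual {false} refl a = refl

  embL-dual : ∀ {p q} (e : q ≡ not p) (b : LnSort M p) →
    embL (dual M) q (Inverse.to (LnSort-dual-↔ e) b) ≡ swap (embL M p b)
  embL-dual {true}  refl b = refl
  embL-dual {false} refl b = refl

  Inc±-dual : ∀ x y → Inc± M x y ⇔ Inc± (dual M) (swap x) (swap y)
  Inc±-dual (inj₁ _) (inj₁ _) = ⇔-id _
  Inc±-dual (inj₁ _) (inj₂ _) = ⇔-id _
  Inc±-dual (inj₂ _) (inj₁ _) = ⇔-id _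
  Inc±-dual (inj₂ _) (inj₂ _) = ⇔-id _

  module _ {X : Index} (alt : Alternating X) where
    open Alternating alt

    next-≡-⇔ : ∀ {i j} → i ≡ j ⇔ next X i ≡ next X j
    next-≡-⇔ = mk⇔ (cong (next X)) next-injective

    incidence-next : ∀ {i j} {x y} {x′ y′} → x′ ≡ swap x → y′ ≡ swap y →
      ((i ≡ j × Inc± M x y) ⊎ (i ≡ next X j × x ≡ y)) ⇔
      ((next X i ≡ next X j × Inc± (dual M) x′ y′) ⊎ (next X i ≡ next X (next X j) × x′ ≡ y′))
    incidence-next {x = x} {y} refl refl = (next-≡-⇔ ×-⇔ Inc±-dual x y) ⊎-⇔ (next-≡-⇔ ×-⇔ swap-≡-⇔)

    ⊛∘-≅-dual-⊛∘ : M ⊛∘ X ≅ dual M ⊛∘ X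
    ⊛∘-≅-dual-⊛∘ = record
      { ptBij   = ↔⇒⤖ (Σ-↔ next-↔ (PtSort-dual-↔ (even?-next _)))
      ; lnBij   = ↔⇒⤖ (Σ-↔ next-↔ (LnSort-dual-↔ (even?-next _)))
      ; incPres = λ { (i , a) (j , b) →
          incidence-next (embP-dual (even?-next i) a) (embL-dual (even?-next j) b) }
      }

evenℕ-+1 : ∀ n → evenℕ (n + 1) ≡ not (evenℕ n)
evenℕ-+1 n = cong evenℕ (+-comm n 1)

ℤIdx-alternating : Alternating ℤIdx
ℤIdx-alternating = record
  { prev       = _+ℤ -1ℤ
  ; next-prev  = λ j → trans (+-assoc j -1ℤ 1ℤ) (+-identityʳ j)
  ; prev-next  = λ i → trans (+-assoc i 1ℤ -1ℤ) (+-identityʳ i)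
  ; even?-next = even?-next
  }
  where
  even?-next : ∀ i → evenℤ (i +ℤ 1ℤ) ≡ not (evenℤ i)
  even?-next (+ n)        = evenℕ-+1 n
  even?-next -[1+ zero ]  = refl
  even?-next -[1+ suc n ] = sym (not-involutive _)

module _ {m : ℕ} where

  nextFin-fromℕ : nextFin (fromℕ m) ≡ zero
  nextFin-fromℕ = toℕ-injective (begin
    toℕ (nextFin (fromℕ m))     ≡⟨ toℕ-fromℕ< _ ⟩
    suc (toℕ (fromℕ m)) % suc m ≡⟨ cong (λ n → suc n % suc m) (toℕ-fromℕ m) ⟩
    suc m % suc m               ≡⟨ n%n≡0 (suc m) ⟩
    0                           ∎)
    where open ≡-Reasoning

  nextFin-inject₁ : (j : Fin m) → nextFin (inject₁ j) ≡ suc j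
  nextFin-inject₁ j = toℕ-injective (begin
    toℕ (nextFin (inject₁ j))     ≡⟨ toℕ-fromℕ< _ ⟩
    suc (toℕ (inject₁ j)) % suc m ≡⟨ cong (λ n → suc n % suc m) (toℕ-inject₁ j) ⟩
    suc (toℕ j) % suc m           ≡⟨ m<n⇒m%n≡m (s≤s (toℕ<n j)) ⟩
    suc (toℕ j)                   ∎)
    where open ≡-Reasoning

CIdx-alternating : ∀ {k} → evenℕ k ≡ true → Alternating (CIdx k)
CIdx-alternating {zero} _ = record
  { prev = λ () ; next-prev = λ () ; prev-next = λ () ; even?-next = λ () }
CIdx-alternating {suc m} even-k = record
  { prev       = prev
  ; next-prev  = next-prev
  ; prev-next  = prev-next
  ; even?-next = even?-next
  }
  where
  prev : Fin (suc m) → Fin (suc m)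
  prev zero    = fromℕ m
  prev (suc j) = inject₁ j

  next-prev : ∀ j → nextFin (prev j) ≡ j
  next-prev zero    = nextFin-fromℕ
  next-prev (suc j) = nextFin-inject₁ j

  prev-next : ∀ i → prev (nextFin i) ≡ i
  prev-next i with view i
  ... | ‵fromℕ         rewrite nextFin-fromℕ {m} = refl
  ... | ‵inj₁ {i = j} _ rewrite nextFin-inject₁ j = refl

  -- the wrap-around step m ↦ 0 flips parity exactly because k = m + 1 is even
  even?-next : ∀ i → evenℕ (toℕ (nextFin i)) ≡ not (evenℕ (toℕ i))
  even?-next i with view i
  ... | ‵fromℕ         rewrite nextFin-fromℕ {m} | toℕ-fromℕ m = sym even-k
  ... | ‵inj₁ {i = j} _ rewrite nextFin-inject₁ j | toℕ-inject₁ j = refl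

evenℕ-*2 : ∀ q → evenℕ (q * 2) ≡ true
evenℕ-*2 zero    = refl
evenℕ-*2 (suc q) = trans (not-involutive _) (evenℕ-*2 q)

evenℕ-if-2∣ : ∀ {k} → 2 ∣ k → evenℕ k ≡ true
evenℕ-if-2∣ (divides q refl) = evenℕ-*2 q

proposition2p4 : (M : IncStr) → IsPLS M →
    (M ⊛∘ ℤIdx ≅ dual M ⊛∘ ℤIdx)
    × (∀ (k : ℕ) → 2 ∣ k → 2 < k → M ⊛∘ CIdx k ≅ dual M ⊛∘ CIdx k)
proposition2p4 M _ =
    ⊛∘-≅-dual-⊛∘ M ℤIdx-alternating
  , λ k 2∣k _ → ⊛∘-≅-dual-⊛∘ M (CIdx-alternating (evenℕ-if-2∣ 2∣k))
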